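{- Let $n$, $r$ and $s$ be non-negative integers with $n\geq r\geq s$. If $s$ is odd, then \[ \sum_{j=1}^{\lfloor n/2\rfloor}\binom{n-r}{2j-s}5^jj=2^{n-r-3}5^{\frac{s+1}{2}}\big((n-r)L_{n-r-1}+2sF_{n-r}\big), \] \[ \sum_{j=1}^{\lfloor n/2\rfloor}\binom{n-r}{2j+1-s}5^jj=2^{n-r-3}5^{\frac{s-1}{2}}\big(5(n-r)F_{n-r-1}+2(s-1)L_{n-r}\big), \] while if $s$ is even, then \[ \sum_{j=1}^{\lfloor n/2\rfloor}\binom{n-r}{2j-s}5^jj=2^{n-r-3}5^{\frac{s}{2}}\big(5(n-r)F_{n-r-1}+2sL_{n-r}\big), \] \[ \sum_{j=1}^{\lfloor n/2\rfloor}\binom{n-r}{2j+1-s}5^jj=2^{n-r-3}5^{\frac{s}{2}}\big((n-r)L_{n-r-1}+2(s-1)F_{n-r}\big). \]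
   Context: $F_n$ and $L_n$ are the Fibonacci and Lucas numbers ($F_0=0,F_1=1$, $L_0=2,L_1=1$, $X_n=X_{n-1}+X_{n-2}$), extended to negative indices by $F_{ -n}=(-1)^{n-1}F_n$, $L_{ -n}=(-1)^nL_n$. $\lfloor x\rfloor$ is the floor function; binomial coefficients $\binom{N}{i}$ are $0$ when $i<0$ or $i>N$. -}

module Defs where

open import Data.Nat as ℕ using (ℕ; zero; suc)
open import Data.Nat.Combinatorics using (_C_)
open import Data.Integer as ℤ using (ℤ; +_; -[1+_])

fibℕ : ℕ → ℤ
fibℕ 0 = + 0
fibℕ 1 = + 1
fibℕ (suc (suc n)) = fibℕ (suc n) ℤ.+ fibℕ n

lucℕ : ℕ → ℤ
lucℕ 0 = + 2
lucℕ 1 = + 1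
lucℕ (suc (suc n)) = lucℕ (suc n) ℤ.+ lucℕ n

sgn : ℕ → ℤ
sgn k = (ℤ.- (+ 1)) ℤ.^ k

-- Extension to integer indices: F_{-m} = (-1)^(m-1) F_m, L_{-m} = (-1)^m L_m.
-- For -[1+ k] (i.e. -m with m = k+1): (-1)^(m-1) = (-1)^k, (-1)^m = (-1)^(k+1).
F : ℤ → ℤ
F (+ n) = fibℕ n
F -[1+ k ] = sgn k ℤ.* fibℕ (suc k)

L : ℤ → ℤ
L (+ n) = lucℕ n
L -[1+ k ] = sgn (suc k) ℤ.* lucℕ (suc k)

-- Binomial coefficient with integer lower index; 0 for i < 0 or i > N
-- (the latter is already the behaviour of _C_ on ℕ).
binom : ℕ → ℤ → ℤ
binom N (+ i) = + (N C i)
binom N -[1+ _ ] = + 0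

sumFrom1 : ℕ → (ℕ → ℤ) → ℤ
sumFrom1 zero f = + 0
sumFrom1 (suc m) f = sumFrom1 m f ℤ.+ f (suc m)

{-# OPTIONS --safe #-}
module Submission where

-- Write (1 + √5)^N = A + √5 B with A = Σₖ C(N,2k) 5^k and B = Σₖ C(N,2k+1) 5^k.
-- By Binet, 2A = 2^N L_N and 2B = 2^N F_N, and the k-weighted versions are
-- 8 Σₖ k C(N,2k) 5^k = 2^N·5N F_{N-1} and 8 Σₖ k C(N,2k+1) 5^k = 2^N (N L_{N-1} - 2F_N).
-- All four follow together by induction on N from Pascal's rule, for sums truncated at k ≤ b
-- with 2b + 1 ≥ N (2b + 2 ≥ N for the odd ones), which lose no terms. In the theorem, putting
-- j = t + k with t chosen so that 2j - s (resp. 2j + 1 - s) is 2k or 2k + 1 turns each sum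
-- into 5^t (weighted sum + t · plain sum) for N = n - r; the terms with j < t and j > ⌊n/2⌋
-- vanish because the binomial index is negative or exceeds N.

open import Defs
open import Data.Nat using (ℕ; _≤_; _∸_; _%_; _/_) renaming (_*_ to _*ℕ_; _+_ to _+ℕ_)
open import Data.Integer using (ℤ; +_; _+_; _-_; _*_; _^_)
open import Data.Product using (_×_)
open import Relation.Binary.PropositionalEquality using (_≡_)

open import Data.Nat using (zero; suc; z≤n; s≤s; _<_)
import Data.Nat.Properties as ℕ
import Data.Nat.DivMod as ℕ
import Data.Nat.Tactic.RingSolver as ℕ-Solver
open import Data.Nat.Combinatorics using (_C_; nCk+nC[k+1]≡[n+1]C[k+1]; k>n⇒nCk≡0)
open import Data.Integer using (-_)
import Data.Integer.Properties as ℤ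
open import Data.Integer.Tactic.RingSolver using (solve; solve-∀)
open import Algebra.Properties.CommutativeSemigroup ℤ.+-commutativeSemigroup
  using (interchange)
open import Algebra.Properties.CommutativeSemigroup ℤ.*-commutativeSemigroup
  using (x∙yz≈y∙xz; x∙yz≈yx∙z)
open import Data.List using (_∷_; [])
open import Data.Product using (_,_)
open import Relation.Binary.PropositionalEquality
  using (refl; sym; trans; cong; cong₂; subst; module ≡-Reasoning)

m≡2[m/2]+m%2 : ∀ m → m ≡ 2 *ℕ (m / 2) +ℕ m % 2
m≡2[m/2]+m%2 m = trans (ℕ.m≡m%n+[m/n]*n m 2)
  (trans (ℕ.+-comm (m % 2) _) (cong (_+ℕ m % 2) (ℕ.*-comm (m / 2) 2)))

m≤1+2[m/2] : ∀ m → m ≤ suc (2 *ℕ (m / 2))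
m≤1+2[m/2] m = begin
  m                      ≡⟨ m≡2[m/2]+m%2 m ⟩
  2 *ℕ (m / 2) +ℕ m % 2  ≤⟨ ℕ.+-monoʳ-≤ (2 *ℕ (m / 2)) (ℕ.≤-pred (ℕ.m%n<n m 2)) ⟩
  2 *ℕ (m / 2) +ℕ 1      ≡⟨ ℕ.+-comm _ 1 ⟩
  suc (2 *ℕ (m / 2))     ∎
  where open ℕ.≤-Reasoning

m/2<j⇒m<2j : ∀ m {j} → m / 2 < j → m < 2 *ℕ j
m/2<j⇒m<2j m {j} m/2<j = begin-strict
  m                   ≤⟨ m≤1+2[m/2] m ⟩
  suc (2 *ℕ (m / 2))  <⟨ ℕ.n<1+n _ ⟩
  2 +ℕ 2 *ℕ (m / 2)   ≡⟨ ℕ.*-suc 2 (m / 2) ⟨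
  2 *ℕ suc (m / 2)    ≤⟨ ℕ.*-monoʳ-≤ 2 m/2<j ⟩
  2 *ℕ j              ∎
  where open ℕ.≤-Reasoning

2m/2≡m : ∀ m → 2 *ℕ m / 2 ≡ m
2m/2≡m m = trans (cong (_/ 2) (ℕ.*-comm 2 m)) (ℕ.m*n/n≡m m 2)

m%2≡0⇒m≡2[m/2] : ∀ m → m % 2 ≡ 0 → m ≡ 2 *ℕ (m / 2) +ℕ 0
m%2≡0⇒m≡2[m/2] m m%2≡0 = trans (m≡2[m/2]+m%2 m) (cong (2 *ℕ (m / 2) +ℕ_) m%2≡0)

m%2≡0⇒m+1≡2[m/2]+1 : ∀ m → m % 2 ≡ 0 → m +ℕ 1 ≡ 2 *ℕ (m / 2) +ℕ 1
m%2≡0⇒m+1≡2[m/2]+1 m m%2≡0 = trans (cong (_+ℕ 1) (m%2≡0⇒m≡2[m/2] m m%2≡0)) (cong (_+ℕ 1) (ℕ.+-identityʳ _))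

m%2≡1⇒m≡2[[m∸1]/2]+1 : ∀ m → m % 2 ≡ 1 → m ≡ 2 *ℕ ((m ∸ 1) / 2) +ℕ 1
m%2≡1⇒m≡2[[m∸1]/2]+1 m m%2≡1 = trans m≡2[m/2]+1 (cong (λ x → 2 *ℕ x +ℕ 1) (sym [m∸1]/2≡m/2))
  where
  m≡2[m/2]+1 : m ≡ 2 *ℕ (m / 2) +ℕ 1
  m≡2[m/2]+1 = trans (m≡2[m/2]+m%2 m) (cong (2 *ℕ (m / 2) +ℕ_) m%2≡1)
  [m∸1]/2≡m/2 : (m ∸ 1) / 2 ≡ m / 2
  [m∸1]/2≡m/2 = trans (cong (λ x → (x ∸ 1) / 2) m≡2[m/2]+1)
    (trans (cong (_/ 2) (ℕ.m+n∸n≡m (2 *ℕ (m / 2)) 1)) (2m/2≡m (m / 2)))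

m%2≡1⇒m+1≡2[[m+1]/2] : ∀ m → m % 2 ≡ 1 → m +ℕ 1 ≡ 2 *ℕ ((m +ℕ 1) / 2) +ℕ 0
m%2≡1⇒m+1≡2[[m+1]/2] m m%2≡1 =
  m%2≡0⇒m≡2[m/2] (m +ℕ 1) (trans (ℕ.%-distribˡ-+ m 1 2) (cong (λ x → (x +ℕ 1 % 2) % 2) m%2≡1))

x≤m∧m/2<j⇒x<2j+e : ∀ {x m j} e → x ≤ m → m / 2 < j → x < 2 *ℕ j +ℕ e
x≤m∧m/2<j⇒x<2j+e {m = m} {j} e x≤m m/2<j =
  ℕ.≤-<-trans x≤m (ℕ.<-≤-trans (m/2<j⇒m<2j m m/2<j) (ℕ.m≤m+n (2 *ℕ j) e))

j<t⇒2j+e<2t+e : ∀ {j t s} e → j < t → s ≡ 2 *ℕ t +ℕ e → 2 *ℕ j +ℕ e < s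
j<t⇒2j+e<2t+e e j<t refl = ℕ.+-monoˡ-< e (ℕ.*-monoʳ-< 2 j<t)

j<t⇒2j+e<2t+e-1 : ∀ {j t s} e → j < t → s +ℕ 1 ≡ 2 *ℕ t +ℕ e → 2 *ℕ j +ℕ e < s
j<t⇒2j+e<2t+e-1 {j} {t} {s} e j<t s+1≡2t+e = ℕ.+-cancelʳ-≤ 1 (suc (2 *ℕ j +ℕ e)) s (begin
  suc (2 *ℕ j +ℕ e) +ℕ 1  ≡⟨ rearrange j e ⟩
  2 *ℕ suc j +ℕ e         ≤⟨ ℕ.+-monoˡ-≤ e (ℕ.*-monoʳ-≤ 2 j<t) ⟩
  2 *ℕ t +ℕ e             ≡⟨ s+1≡2t+e ⟨
  s +ℕ 1                  ∎)
  where
  open ℕ.≤-Reasoning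
  rearrange : ∀ j e → suc (2 *ℕ j +ℕ e) +ℕ 1 ≡ 2 *ℕ suc j +ℕ e
  rearrange = ℕ-Solver.solve-∀

open ≡-Reasoning

2*fibℕ[1+n] : ∀ n → + 2 * fibℕ (suc n) ≡ fibℕ n + lucℕ n
2*fibℕ[1+n] zero = refl
2*fibℕ[1+n] (suc zero) = refl
2*fibℕ[1+n] (suc (suc n)) = begin
  + 2 * (fibℕ (suc (suc n)) + fibℕ (suc n))
    ≡⟨ ℤ.*-distribˡ-+ (+ 2) (fibℕ (suc (suc n))) (fibℕ (suc n)) ⟩
  + 2 * fibℕ (suc (suc n)) + + 2 * fibℕ (suc n)
    ≡⟨ cong₂ _+_ (2*fibℕ[1+n] (suc n)) (2*fibℕ[1+n] n) ⟩
  (fibℕ (suc n) + lucℕ (suc n)) + (fibℕ n + lucℕ n)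
    ≡⟨ interchange (fibℕ (suc n)) (lucℕ (suc n)) (fibℕ n) (lucℕ n) ⟩
  fibℕ (suc (suc n)) + lucℕ (suc (suc n))
    ∎

2*lucℕ[1+n] : ∀ n → + 2 * lucℕ (suc n) ≡ lucℕ n + + 5 * fibℕ n
2*lucℕ[1+n] zero = refl
2*lucℕ[1+n] (suc zero) = refl
2*lucℕ[1+n] (suc (suc n)) = begin
  + 2 * (lucℕ (suc (suc n)) + lucℕ (suc n))
    ≡⟨ ℤ.*-distribˡ-+ (+ 2) (lucℕ (suc (suc n))) (lucℕ (suc n)) ⟩
  + 2 * lucℕ (suc (suc n)) + + 2 * lucℕ (suc n)
    ≡⟨ cong₂ _+_ (2*lucℕ[1+n] (suc n)) (2*lucℕ[1+n] n) ⟩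
  (lucℕ (suc n) + + 5 * fibℕ (suc n)) + (lucℕ n + + 5 * fibℕ n)
    ≡⟨ interchange (lucℕ (suc n)) (+ 5 * fibℕ (suc n)) (lucℕ n) (+ 5 * fibℕ n) ⟩
  lucℕ (suc (suc n)) + (+ 5 * fibℕ (suc n) + + 5 * fibℕ n)
    ≡⟨ cong (_+_ (lucℕ (suc (suc n)))) (ℤ.*-distribˡ-+ (+ 5) (fibℕ (suc n)) (fibℕ n)) ⟨
  lucℕ (suc (suc n)) + + 5 * fibℕ (suc (suc n))
    ∎

nF[n-1] nL[n-1] : ℕ → ℤ
nF[n-1] n = + n * F (+ n - + 1)
nL[n-1] n = + n * L (+ n - + 1)

nF[n-1]+nL[n-1] : ∀ n → nF[n-1] n + nL[n-1] n ≡ + 2 * + n * fibℕ n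
nF[n-1]+nL[n-1] zero = refl
nF[n-1]+nL[n-1] (suc n) = begin
  + suc n * fibℕ n + + suc n * lucℕ n  ≡⟨ ℤ.*-distribˡ-+ (+ suc n) (fibℕ n) (lucℕ n) ⟨
  + suc n * (fibℕ n + lucℕ n)          ≡⟨ cong (+ suc n *_) (2*fibℕ[1+n] n) ⟨
  + suc n * (+ 2 * fibℕ (suc n))       ≡⟨ x∙yz≈yx∙z (+ suc n) (+ 2) (fibℕ (suc n)) ⟩
  + 2 * + suc n * fibℕ (suc n)         ∎

5nF[n-1]+nL[n-1] : ∀ n → + 5 * nF[n-1] n + nL[n-1] n ≡ + 2 * + n * lucℕ n
5nF[n-1]+nL[n-1] zero = refl
5nF[n-1]+nL[n-1] (suc n) = begin
  + 5 * (+ suc n * fibℕ n) + + suc n * lucℕ n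
    ≡⟨ cong (_+ + suc n * lucℕ n) (x∙yz≈y∙xz (+ 5) (+ suc n) (fibℕ n)) ⟩
  + suc n * (+ 5 * fibℕ n) + + suc n * lucℕ n
    ≡⟨ ℤ.*-distribˡ-+ (+ suc n) (+ 5 * fibℕ n) (lucℕ n) ⟨
  + suc n * (+ 5 * fibℕ n + lucℕ n)
    ≡⟨ cong (+ suc n *_) (ℤ.+-comm (+ 5 * fibℕ n) (lucℕ n)) ⟩
  + suc n * (lucℕ n + + 5 * fibℕ n)
    ≡⟨ cong (+ suc n *_) (2*lucℕ[1+n] n) ⟨
  + suc n * (+ 2 * lucℕ (suc n))
    ≡⟨ x∙yz≈yx∙z (+ suc n) (+ 2) (lucℕ (suc n)) ⟩
  + 2 * + suc n * lucℕ (suc n)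
    ∎

Σ≤ : ℕ → (ℕ → ℤ) → ℤ
Σ≤ zero    f = f 0
Σ≤ (suc b) f = Σ≤ b f + f (suc b)

Σ≤-cong : ∀ b {f g : ℕ → ℤ} → (∀ k → f k ≡ g k) → Σ≤ b f ≡ Σ≤ b g
Σ≤-cong zero    f≗g = f≗g 0
Σ≤-cong (suc b) f≗g = cong₂ _+_ (Σ≤-cong b f≗g) (f≗g (suc b))

Σ≤-0 : ∀ b {f : ℕ → ℤ} → (∀ k → f k ≡ + 0) → Σ≤ b f ≡ + 0
Σ≤-0 zero    f≗0 = f≗0 0
Σ≤-0 (suc b) f≗0 = cong₂ _+_ (Σ≤-0 b f≗0) (f≗0 (suc b))

Σ≤-+ : ∀ b (f g : ℕ → ℤ) → Σ≤ b (λ k → f k + g k) ≡ Σ≤ b f + Σ≤ b g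
Σ≤-+ zero    f g = refl
Σ≤-+ (suc b) f g = trans (cong (_+ (f (suc b) + g (suc b))) (Σ≤-+ b f g))
  (interchange (Σ≤ b f) (Σ≤ b g) (f (suc b)) (g (suc b)))

Σ≤-*ˡ : ∀ b (c : ℤ) (f : ℕ → ℤ) → Σ≤ b (λ k → c * f k) ≡ c * Σ≤ b f
Σ≤-*ˡ zero    c f = refl
Σ≤-*ˡ (suc b) c f =
  trans (cong (_+ c * f (suc b)) (Σ≤-*ˡ b c f)) (sym (ℤ.*-distribˡ-+ c _ _))

Σ≤-suc : ∀ b (f : ℕ → ℤ) → Σ≤ (suc b) f ≡ f 0 + Σ≤ b (λ k → f (suc k))
Σ≤-suc zero    f = refl
Σ≤-suc (suc b) f =
  trans (cong (_+ f (suc (suc b))) (Σ≤-suc b f)) (ℤ.+-assoc (f 0) _ _)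

Σ≤-extend : ∀ t b (f : ℕ → ℤ) → (∀ j → b < j → f j ≡ + 0) → Σ≤ (t +ℕ b) f ≡ Σ≤ b f
Σ≤-extend zero    b f vanish = refl
Σ≤-extend (suc t) b f vanish = begin
  Σ≤ (t +ℕ b) f + f (suc (t +ℕ b))  ≡⟨ cong₂ _+_ (Σ≤-extend t b f vanish) (vanish _ (s≤s (ℕ.m≤n+m b t))) ⟩
  Σ≤ b f + + 0                       ≡⟨ ℤ.+-identityʳ _ ⟩
  Σ≤ b f                             ∎

Σ≤-shift : ∀ t b (f : ℕ → ℤ) → (∀ j → j < t → f j ≡ + 0) →
  Σ≤ (t +ℕ b) f ≡ Σ≤ b (λ k → f (t +ℕ k))
Σ≤-shift zero    b f vanish = refl
Σ≤-shift (suc t) b f vanish = begin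
  Σ≤ (suc (t +ℕ b)) f                   ≡⟨ Σ≤-suc (t +ℕ b) f ⟩
  f 0 + Σ≤ (t +ℕ b) (λ k → f (suc k))   ≡⟨ cong (_+ Σ≤ (t +ℕ b) (λ k → f (suc k))) (vanish 0 (s≤s z≤n)) ⟩
  + 0 + Σ≤ (t +ℕ b) (λ k → f (suc k))   ≡⟨ ℤ.+-identityˡ _ ⟩
  Σ≤ (t +ℕ b) (λ k → f (suc k))         ≡⟨ Σ≤-shift t b (λ k → f (suc k)) (λ j j<t → vanish (suc j) (s≤s j<t)) ⟩
  Σ≤ b (λ k → f (suc (t +ℕ k)))         ∎

Σ≤-step : ∀ b (u v w : ℕ → ℤ) → u 0 ≡ v 0 → (∀ k → u (suc k) ≡ w k + v (suc k)) →
  Σ≤ (suc b) u ≡ Σ≤ (suc b) v + Σ≤ b w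
Σ≤-step b u v w u₀≡v₀ step = begin
  Σ≤ (suc b) u                                    ≡⟨ Σ≤-suc b u ⟩
  u 0 + Σ≤ b (λ k → u (suc k))                    ≡⟨ cong₂ _+_ u₀≡v₀ (Σ≤-cong b step) ⟩
  v 0 + Σ≤ b (λ k → w k + v (suc k))              ≡⟨ cong (_+_ (v 0)) (Σ≤-+ b w (λ k → v (suc k))) ⟩
  v 0 + (Σ≤ b w + Σ≤ b (λ k → v (suc k)))        ≡⟨ cong (_+_ (v 0)) (ℤ.+-comm (Σ≤ b w) _) ⟩
  v 0 + (Σ≤ b (λ k → v (suc k)) + Σ≤ b w)        ≡⟨ ℤ.+-assoc (v 0) _ _ ⟨
  (v 0 + Σ≤ b (λ k → v (suc k))) + Σ≤ b w        ≡⟨ cong (_+ Σ≤ b w) (Σ≤-suc b v) ⟨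
  Σ≤ (suc b) v + Σ≤ b w                           ∎

sumFrom1≡Σ≤ : ∀ b (f : ℕ → ℤ) → f 0 ≡ + 0 → sumFrom1 b f ≡ Σ≤ b f
sumFrom1≡Σ≤ zero    f f₀≡0 = sym f₀≡0
sumFrom1≡Σ≤ (suc b) f f₀≡0 = cong (_+ f (suc b)) (sumFrom1≡Σ≤ b f f₀≡0)

evenTerm oddTerm : ℕ → ℕ → ℤ
evenTerm n k = + (n C (2 *ℕ k)) * (+ 5) ^ k
oddTerm  n k = + (n C suc (2 *ℕ k)) * (+ 5) ^ k

weighted : (ℕ → ℤ) → ℕ → ℤ
weighted f k = f k * + k

pascal : ∀ n i → + (suc n C suc i) ≡ + (n C i) + + (n C suc i)
pascal n i = trans (cong +_ (sym (nCk+nC[k+1]≡[n+1]C[k+1] n i))) (ℤ.pos-+ (n C i) (n C suc i))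

evenTerm-suc : ∀ n k → evenTerm (suc n) (suc k) ≡ + 5 * oddTerm n k + evenTerm n (suc k)
evenTerm-suc n k = begin
  + (suc n C (2 *ℕ suc k)) * (+ 5) ^ suc k
    ≡⟨ cong (λ i → + (suc n C i) * (+ 5) ^ suc k) (ℕ.*-suc 2 k) ⟩
  + (suc n C suc (suc (2 *ℕ k))) * (+ 5) ^ suc k
    ≡⟨ cong (_* (+ 5) ^ suc k) (pascal n (suc (2 *ℕ k))) ⟩
  (+ (n C suc (2 *ℕ k)) + + (n C suc (suc (2 *ℕ k)))) * (+ 5 * (+ 5) ^ k)
    ≡⟨ distrib (+ (n C suc (2 *ℕ k))) (+ (n C suc (suc (2 *ℕ k)))) ((+ 5) ^ k) ⟩
  + 5 * oddTerm n k + + (n C suc (suc (2 *ℕ k))) * (+ 5) ^ suc k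
    ≡⟨ cong (λ i → + 5 * oddTerm n k + + (n C i) * (+ 5) ^ suc k) (ℕ.*-suc 2 k) ⟨
  + 5 * oddTerm n k + evenTerm n (suc k) ∎
  where
  distrib : ∀ a b x → (a + b) * (+ 5 * x) ≡ + 5 * (a * x) + b * (+ 5 * x)
  distrib = solve-∀

oddTerm-suc : ∀ n k → oddTerm (suc n) k ≡ evenTerm n k + oddTerm n k
oddTerm-suc n k = trans (cong (_* (+ 5) ^ k) (pascal n (2 *ℕ k)))
  (ℤ.*-distribʳ-+ ((+ 5) ^ k) (+ (n C (2 *ℕ k))) (+ (n C suc (2 *ℕ k))))

Σ-evenTerm-suc : ∀ n b →
  Σ≤ (suc b) (evenTerm (suc n)) ≡ Σ≤ (suc b) (evenTerm n) + + 5 * Σ≤ b (oddTerm n)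
Σ-evenTerm-suc n b =
  trans (Σ≤-step b (evenTerm (suc n)) (evenTerm n) (λ k → + 5 * oddTerm n k) refl (evenTerm-suc n))
        (cong (_+_ (Σ≤ (suc b) (evenTerm n))) (Σ≤-*ˡ b (+ 5) (oddTerm n)))

Σ-oddTerm-suc : ∀ n b → Σ≤ b (oddTerm (suc n)) ≡ Σ≤ b (evenTerm n) + Σ≤ b (oddTerm n)
Σ-oddTerm-suc n b = trans (Σ≤-cong b (oddTerm-suc n)) (Σ≤-+ b (evenTerm n) (oddTerm n))

Σ-weighted-evenTerm-suc : ∀ n b →
  Σ≤ (suc b) (weighted (evenTerm (suc n)))
  ≡ Σ≤ (suc b) (weighted (evenTerm n)) + + 5 * (Σ≤ b (weighted (oddTerm n)) + Σ≤ b (oddTerm n))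
Σ-weighted-evenTerm-suc n b = begin
  Σ≤ (suc b) (weighted (evenTerm (suc n)))
    ≡⟨ Σ≤-step b _ (weighted (evenTerm n)) (λ k → + 5 * (weighted (oddTerm n) k + oddTerm n k)) refl step ⟩
  Σ≤ (suc b) (weighted (evenTerm n)) + Σ≤ b (λ k → + 5 * (weighted (oddTerm n) k + oddTerm n k))
    ≡⟨ cong (_+_ (Σ≤ (suc b) (weighted (evenTerm n))))
         (trans (Σ≤-*ˡ b (+ 5) _) (cong (+ 5 *_) (Σ≤-+ b (weighted (oddTerm n)) (oddTerm n)))) ⟩
  Σ≤ (suc b) (weighted (evenTerm n)) + + 5 * (Σ≤ b (weighted (oddTerm n)) + Σ≤ b (oddTerm n)) ∎
  where
  spread : ∀ o e k → (+ 5 * o + e) * (+ 1 + k) ≡ + 5 * (o * k + o) + e * (+ 1 + k)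
  spread = solve-∀
  step : ∀ k → weighted (evenTerm (suc n)) (suc k)
             ≡ + 5 * (weighted (oddTerm n) k + oddTerm n k) + weighted (evenTerm n) (suc k)
  step k = trans (cong (_* + suc k) (evenTerm-suc n k)) (spread (oddTerm n k) (evenTerm n (suc k)) (+ k))

Σ-weighted-oddTerm-suc : ∀ n b →
  Σ≤ b (weighted (oddTerm (suc n))) ≡ Σ≤ b (weighted (evenTerm n)) + Σ≤ b (weighted (oddTerm n))
Σ-weighted-oddTerm-suc n b =
  trans (Σ≤-cong b (λ k → trans (cong (_* + k) (oddTerm-suc n k))
                                (ℤ.*-distribʳ-+ (+ k) (evenTerm n k) (oddTerm n k))))
        (Σ≤-+ b (weighted (evenTerm n)) (weighted (oddTerm n)))

-- d and X are parameters because ℤ's _*_ always unfolds, so Agda cannot infer them from d * a.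
module Scaling (d X : ℤ) where

  scale-+ : ∀ {a b l f : ℤ} → d * a ≡ X * l → d * b ≡ X * f → d * (a + b) ≡ X * (l + f)
  scale-+ {a} {b} {l} {f} da≡Xl db≡Xf = begin
    d * (a + b)    ≡⟨ ℤ.*-distribˡ-+ d a b ⟩
    d * a + d * b  ≡⟨ cong₂ _+_ da≡Xl db≡Xf ⟩
    X * l + X * f  ≡⟨ ℤ.*-distribˡ-+ X l f ⟨
    X * (l + f)    ∎

  scale-*ˡ : ∀ {a l : ℤ} (c : ℤ) → d * a ≡ X * l → d * (c * a) ≡ X * (c * l)
  scale-*ˡ {a} {l} c da≡Xl = begin
    d * (c * a)  ≡⟨ x∙yz≈y∙xz d c a ⟩
    c * (d * a)  ≡⟨ cong (c *_) da≡Xl ⟩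
    c * (X * l)  ≡⟨ x∙yz≈y∙xz c X l ⟩
    X * (c * l)  ∎

quadruple : ∀ X {a l : ℤ} → + 2 * a ≡ X * l → + 8 * a ≡ X * (+ 4 * l)
quadruple X {a} 2a≡Xl = trans (ℤ.*-assoc (+ 2) (+ 4) a) (Scaling.scale-*ˡ (+ 2) X (+ 4) 2a≡Xl)

2*Σ-evenTerm : ∀ n b → n ≤ suc (2 *ℕ b) → + 2 * Σ≤ b (evenTerm n) ≡ (+ 2) ^ n * lucℕ n
2*Σ-oddTerm  : ∀ n b → n ≤ suc (suc (2 *ℕ b)) → + 2 * Σ≤ b (oddTerm n) ≡ (+ 2) ^ n * fibℕ n

2*Σ-evenTerm zero b _ = cong (+ 2 *_)
  (trans (cong (λ x → Σ≤ x (evenTerm 0)) (sym (ℕ.+-identityʳ b))) (Σ≤-extend b 0 (evenTerm 0) vanish))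
  where
  vanish : ∀ j → 0 < j → evenTerm 0 j ≡ + 0
  vanish (suc j) _ = refl
2*Σ-evenTerm (suc zero) zero _ = refl
2*Σ-evenTerm (suc (suc n)) zero (s≤s ())
2*Σ-evenTerm (suc n) (suc b) (s≤s n≤2[1+b]) = begin
  + 2 * Σ≤ (suc b) (evenTerm (suc n))                       ≡⟨ cong (+ 2 *_) (Σ-evenTerm-suc n b) ⟩
  + 2 * (Σ≤ (suc b) (evenTerm n) + + 5 * Σ≤ b (oddTerm n))  ≡⟨ scale-+ even (scale-*ˡ (+ 5) odd) ⟩
  (+ 2) ^ n * (lucℕ n + + 5 * fibℕ n)                       ≡⟨ cong ((+ 2) ^ n *_) (2*lucℕ[1+n] n) ⟨
  (+ 2) ^ n * (+ 2 * lucℕ (suc n))                          ≡⟨ x∙yz≈yx∙z ((+ 2) ^ n) (+ 2) (lucℕ (suc n)) ⟩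
  (+ 2) ^ suc n * lucℕ (suc n)                              ∎
  where
  open Scaling (+ 2) ((+ 2) ^ n)
  even : + 2 * Σ≤ (suc b) (evenTerm n) ≡ (+ 2) ^ n * lucℕ n
  even = 2*Σ-evenTerm n (suc b) (ℕ.m≤n⇒m≤1+n n≤2[1+b])
  odd : + 2 * Σ≤ b (oddTerm n) ≡ (+ 2) ^ n * fibℕ n
  odd = 2*Σ-oddTerm n b (subst (n ≤_) (ℕ.*-suc 2 b) n≤2[1+b])

2*Σ-oddTerm zero b _ = cong (+ 2 *_) (Σ≤-0 b (λ k → refl))
2*Σ-oddTerm (suc n) b (s≤s n≤1+2b) = begin
  + 2 * Σ≤ b (oddTerm (suc n))                    ≡⟨ cong (+ 2 *_) (Σ-oddTerm-suc n b) ⟩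
  + 2 * (Σ≤ b (evenTerm n) + Σ≤ b (oddTerm n))    ≡⟨ scale-+ even odd ⟩
  (+ 2) ^ n * (lucℕ n + fibℕ n)                   ≡⟨ cong ((+ 2) ^ n *_) (ℤ.+-comm (lucℕ n) (fibℕ n)) ⟩
  (+ 2) ^ n * (fibℕ n + lucℕ n)                   ≡⟨ cong ((+ 2) ^ n *_) (2*fibℕ[1+n] n) ⟨
  (+ 2) ^ n * (+ 2 * fibℕ (suc n))                ≡⟨ x∙yz≈yx∙z ((+ 2) ^ n) (+ 2) (fibℕ (suc n)) ⟩
  (+ 2) ^ suc n * fibℕ (suc n)                    ∎
  where
  open Scaling (+ 2) ((+ 2) ^ n)
  even : + 2 * Σ≤ b (evenTerm n) ≡ (+ 2) ^ n * lucℕ n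
  even = 2*Σ-evenTerm n b n≤1+2b
  odd : + 2 * Σ≤ b (oddTerm n) ≡ (+ 2) ^ n * fibℕ n
  odd = 2*Σ-oddTerm n b (ℕ.m≤n⇒m≤1+n n≤1+2b)

8*Σ-weighted-evenTerm : ∀ n b → n ≤ suc (2 *ℕ b) →
  + 8 * Σ≤ b (weighted (evenTerm n)) ≡ (+ 2) ^ n * (+ 5 * nF[n-1] n)
8*Σ-weighted-oddTerm  : ∀ n b → n ≤ suc (suc (2 *ℕ b)) →
  + 8 * Σ≤ b (weighted (oddTerm n)) ≡ (+ 2) ^ n * (nL[n-1] n - + 2 * fibℕ n)

8*Σ-weighted-evenTerm zero b _ = cong (+ 8 *_) (Σ≤-0 b vanish)
  where
  vanish : ∀ k → weighted (evenTerm 0) k ≡ + 0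
  vanish zero    = refl
  vanish (suc k) = refl
8*Σ-weighted-evenTerm (suc zero) zero _ = refl
8*Σ-weighted-evenTerm (suc (suc n)) zero (s≤s ())
8*Σ-weighted-evenTerm (suc n) (suc b) (s≤s n≤2[1+b]) = begin
  + 8 * Σ≤ (suc b) (weighted (evenTerm (suc n)))
    ≡⟨ cong (+ 8 *_) (Σ-weighted-evenTerm-suc n b) ⟩
  + 8 * (Σ≤ (suc b) (weighted (evenTerm n)) + + 5 * (Σ≤ b (weighted (oddTerm n)) + Σ≤ b (oddTerm n)))
    ≡⟨ scale-+ weightedEven (scale-*ˡ (+ 5) (scale-+ weightedOdd (quadruple ((+ 2) ^ n) odd))) ⟩
  (+ 2) ^ n * (+ 5 * nF[n-1] n + + 5 * ((nL[n-1] n - + 2 * fibℕ n) + + 4 * fibℕ n))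
    ≡⟨ cong ((+ 2) ^ n *_) (regroup (nF[n-1] n) (nL[n-1] n) (fibℕ n)) ⟩
  (+ 2) ^ n * (+ 5 * (nF[n-1] n + nL[n-1] n) + + 10 * fibℕ n)
    ≡⟨ cong (λ x → (+ 2) ^ n * (+ 5 * x + + 10 * fibℕ n)) (nF[n-1]+nL[n-1] n) ⟩
  (+ 2) ^ n * (+ 5 * (+ 2 * + n * fibℕ n) + + 10 * fibℕ n)
    ≡⟨ factor ((+ 2) ^ n) (+ n) (fibℕ n) ⟩
  (+ 2) ^ suc n * (+ 5 * nF[n-1] (suc n))
    ∎
  where
  open Scaling (+ 8) ((+ 2) ^ n)
  weightedEven : + 8 * Σ≤ (suc b) (weighted (evenTerm n)) ≡ (+ 2) ^ n * (+ 5 * nF[n-1] n)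
  weightedEven = 8*Σ-weighted-evenTerm n (suc b) (ℕ.m≤n⇒m≤1+n n≤2[1+b])
  n≤2+2b : n ≤ suc (suc (2 *ℕ b))
  n≤2+2b = subst (n ≤_) (ℕ.*-suc 2 b) n≤2[1+b]
  weightedOdd : + 8 * Σ≤ b (weighted (oddTerm n)) ≡ (+ 2) ^ n * (nL[n-1] n - + 2 * fibℕ n)
  weightedOdd = 8*Σ-weighted-oddTerm n b n≤2+2b
  odd : + 2 * Σ≤ b (oddTerm n) ≡ (+ 2) ^ n * fibℕ n
  odd = 2*Σ-oddTerm n b n≤2+2b
  regroup : ∀ g h f → + 5 * g + + 5 * ((h - + 2 * f) + + 4 * f) ≡ + 5 * (g + h) + + 10 * f
  regroup = solve-∀
  factor : ∀ X m f → X * (+ 5 * (+ 2 * m * f) + + 10 * f) ≡ (+ 2 * X) * (+ 5 * ((+ 1 + m) * f))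
  factor = solve-∀

8*Σ-weighted-oddTerm zero b _ = cong (+ 8 *_) (Σ≤-0 b (λ k → refl))
8*Σ-weighted-oddTerm (suc n) b (s≤s n≤1+2b) = begin
  + 8 * Σ≤ b (weighted (oddTerm (suc n)))
    ≡⟨ cong (+ 8 *_) (Σ-weighted-oddTerm-suc n b) ⟩
  + 8 * (Σ≤ b (weighted (evenTerm n)) + Σ≤ b (weighted (oddTerm n)))
    ≡⟨ scale-+ weightedEven weightedOdd ⟩
  (+ 2) ^ n * (+ 5 * nF[n-1] n + (nL[n-1] n - + 2 * fibℕ n))
    ≡⟨ cong ((+ 2) ^ n *_) (regroup (nF[n-1] n) (nL[n-1] n) (fibℕ n)) ⟩
  (+ 2) ^ n * ((+ 5 * nF[n-1] n + nL[n-1] n) - + 2 * fibℕ n)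
    ≡⟨ cong (λ x → (+ 2) ^ n * (x - + 2 * fibℕ n)) (5nF[n-1]+nL[n-1] n) ⟩
  (+ 2) ^ n * (+ 2 * + n * lucℕ n - + 2 * fibℕ n)
    ≡⟨ factor ((+ 2) ^ n) (+ n) (lucℕ n) (fibℕ n) ⟩
  (+ 2) ^ suc n * (+ suc n * lucℕ n - (fibℕ n + lucℕ n))
    ≡⟨ cong (λ x → (+ 2) ^ suc n * (+ suc n * lucℕ n - x)) (2*fibℕ[1+n] n) ⟨
  (+ 2) ^ suc n * (nL[n-1] (suc n) - + 2 * fibℕ (suc n))
    ∎
  where
  open Scaling (+ 8) ((+ 2) ^ n)
  weightedEven : + 8 * Σ≤ b (weighted (evenTerm n)) ≡ (+ 2) ^ n * (+ 5 * nF[n-1] n)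
  weightedEven = 8*Σ-weighted-evenTerm n b n≤1+2b
  weightedOdd : + 8 * Σ≤ b (weighted (oddTerm n)) ≡ (+ 2) ^ n * (nL[n-1] n - + 2 * fibℕ n)
  weightedOdd = 8*Σ-weighted-oddTerm n b (ℕ.m≤n⇒m≤1+n n≤1+2b)
  regroup : ∀ g h f → + 5 * g + (h - + 2 * f) ≡ (+ 5 * g + h) - + 2 * f
  regroup = solve-∀
  factor : ∀ X m l f → X * (+ 2 * m * l - + 2 * f) ≡ (+ 2 * X) * ((+ 1 + m) * l - (f + l))
  factor = solve-∀

+[m+n]-+n≡+m : ∀ m n → + (m +ℕ n) - + n ≡ + m
+[m+n]-+n≡+m m n = trans (ℤ.[+m]-[+n]≡m⊖n (m +ℕ n) n)
  (trans (ℤ.⊖-≥ (ℕ.m≤n+m n m)) (cong +_ (ℕ.m+n∸n≡m m n)))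

binom-neg : ∀ n {i} → 0 < i → binom n (- + i) ≡ + 0
binom-neg n {suc i} _ = refl

binom-below : ∀ n {a s} → a < s → binom n (+ a - + s) ≡ + 0
binom-below n {a} {s} a<s =
  trans (cong (binom n) (trans (ℤ.[+m]-[+n]≡m⊖n a s) (ℤ.⊖-< a<s))) (binom-neg n (ℕ.m<n⇒0<n∸m a<s))

binom-above : ∀ n {a s} → n +ℕ s < a → binom n (+ a - + s) ≡ + 0
binom-above n {a} {s} n+s<a = begin
  binom n (+ a - + s)             ≡⟨ cong (λ x → binom n (+ x - + s)) (ℕ.m∸n+n≡m s≤a) ⟨
  binom n (+ (a ∸ s +ℕ s) - + s)  ≡⟨ cong (binom n) (+[m+n]-+n≡+m (a ∸ s) s) ⟩
  + (n C (a ∸ s))                 ≡⟨ cong +_ (k>n⇒nCk≡0 (ℕ.m+n≤o⇒m≤o∸n (suc n) n+s<a)) ⟩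
  + 0                             ∎
  where
  s≤a : s ≤ a
  s≤a = ℕ.≤-trans (ℕ.m≤n+m s n) (ℕ.<⇒≤ n+s<a)

Σ-binom-reindex : ∀ n s b t (a c : ℕ → ℕ) →
  (∀ j → b < j → n +ℕ s < a j) → (∀ j → j < t → a j < s) → (∀ k → a (t +ℕ k) ≡ c k +ℕ s) →
  sumFrom1 b (λ j → binom n (+ a j - + s) * (+ 5) ^ j * + j)
  ≡ (+ 5) ^ t * (Σ≤ b (weighted (λ k → + (n C c k) * (+ 5) ^ k))
                 + + t * Σ≤ b (λ k → + (n C c k) * (+ 5) ^ k))
Σ-binom-reindex n s b t a c above below shifted = begin
  sumFrom1 b f
    ≡⟨ sumFrom1≡Σ≤ b f (ℤ.*-zeroʳ (binom n (+ a 0 - + s) * + 1)) ⟩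
  Σ≤ b f
    ≡⟨ Σ≤-extend t b f (λ j b<j → vanishing (binom-above n (above j b<j))) ⟨
  Σ≤ (t +ℕ b) f
    ≡⟨ Σ≤-shift t b f (λ j j<t → vanishing (binom-below n (below j j<t))) ⟩
  Σ≤ b (λ k → f (t +ℕ k))
    ≡⟨ Σ≤-cong b shifted-term ⟩
  Σ≤ b (λ k → (+ 5) ^ t * (weighted u k + + t * u k))
    ≡⟨ Σ≤-*ˡ b ((+ 5) ^ t) (λ k → weighted u k + + t * u k) ⟩
  (+ 5) ^ t * Σ≤ b (λ k → weighted u k + + t * u k)
    ≡⟨ cong ((+ 5) ^ t *_) (Σ≤-+ b (weighted u) (λ k → + t * u k)) ⟩
  (+ 5) ^ t * (Σ≤ b (weighted u) + Σ≤ b (λ k → + t * u k))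
    ≡⟨ cong (λ x → (+ 5) ^ t * (Σ≤ b (weighted u) + x)) (Σ≤-*ˡ b (+ t) u) ⟩
  (+ 5) ^ t * (Σ≤ b (weighted u) + + t * Σ≤ b u)
    ∎
  where
  f u : ℕ → ℤ
  f j = binom n (+ a j - + s) * (+ 5) ^ j * + j
  u k = + (n C c k) * (+ 5) ^ k
  vanishing : ∀ {j} → binom n (+ a j - + s) ≡ + 0 → f j ≡ + 0
  vanishing {j} binom≡0 = cong (λ x → x * (+ 5) ^ j * + j) binom≡0
  rearrange : ∀ B P Q T K → B * (P * Q) * (T + K) ≡ P * (B * Q * K + T * (B * Q))
  rearrange = solve-∀
  shifted-term : ∀ k → f (t +ℕ k) ≡ (+ 5) ^ t * (weighted u k + + t * u k)
  shifted-term k = begin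
    binom n (+ a (t +ℕ k) - + s) * (+ 5) ^ (t +ℕ k) * (+ t + + k)
      ≡⟨ cong₂ (λ x y → x * y * (+ t + + k)) binom≡ (ℤ.^-distribˡ-+-* (+ 5) t k) ⟩
    + (n C c k) * ((+ 5) ^ t * (+ 5) ^ k) * (+ t + + k)
      ≡⟨ rearrange (+ (n C c k)) ((+ 5) ^ t) ((+ 5) ^ k) (+ t) (+ k) ⟩
    (+ 5) ^ t * (weighted u k + + t * u k)
      ∎
    where
    binom≡ : binom n (+ a (t +ℕ k) - + s) ≡ + (n C c k)
    binom≡ = trans (cong (λ x → binom n (+ x - + s)) (shifted k)) (cong (binom n) (+[m+n]-+n≡+m (c k) s))

scaled-combination : ∀ X Y T {W U w l : ℤ} → + 8 * W ≡ X * w → + 2 * U ≡ X * l →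
  + 8 * (Y * (W + T * U)) ≡ X * Y * (w + + 4 * T * l)
scaled-combination X Y T {W} {U} {w} {l} 8W≡Xw 2U≡Xl = begin
  + 8 * (Y * (W + T * U))                   ≡⟨ solve (Y ∷ W ∷ T ∷ U ∷ []) ⟩
  Y * (+ 8 * W) + + 4 * T * Y * (+ 2 * U)   ≡⟨ cong₂ (λ p q → Y * p + + 4 * T * Y * q) 8W≡Xw 2U≡Xl ⟩
  Y * (X * w) + + 4 * T * Y * (X * l)       ≡⟨ solve (X ∷ Y ∷ T ∷ w ∷ l ∷ []) ⟩
  X * Y * (w + + 4 * T * l)                 ∎

+2t≡+s-+e : ∀ {s} t e → s ≡ 2 *ℕ t +ℕ e → + 2 * + t ≡ + s - + e
+2t≡+s-+e t e refl = trans (sym (ℤ.pos-* 2 t)) (sym (+[m+n]-+n≡+m (2 *ℕ t) e))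

-- a and c are abstract because for e = 0 the statement writes 2 * j and + s, not 2 * j + 0 and + s - + 0.
shifted-evenTerm-sum : ∀ N s m t e (a : ℕ → ℕ) {c : ℤ} → N +ℕ s ≤ m →
  (∀ j → a j ≡ 2 *ℕ j +ℕ e) → s ≡ 2 *ℕ t +ℕ e → c ≡ + s - + e →
  + 8 * sumFrom1 (m / 2) (λ j → binom N (+ a j - + s) * (+ 5) ^ j * + j)
  ≡ (+ 2) ^ N * (+ 5) ^ t * (+ 5 * + N * F (+ N - + 1) + + 2 * c * L (+ N))
shifted-evenTerm-sum N s m t e a {c} N+s≤m a≡2j+e s≡2t+e c≡s-e = begin
  + 8 * sumFrom1 (m / 2) (λ j → binom N (+ a j - + s) * (+ 5) ^ j * + j)
    ≡⟨ cong (+ 8 *_) (Σ-binom-reindex N s (m / 2) t a (2 *ℕ_) above below shifted) ⟩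
  + 8 * ((+ 5) ^ t * (Σ≤ (m / 2) (weighted (evenTerm N)) + + t * Σ≤ (m / 2) (evenTerm N)))
    ≡⟨ scaled-combination ((+ 2) ^ N) ((+ 5) ^ t) (+ t)
         (8*Σ-weighted-evenTerm N (m / 2) N≤1+2[m/2]) (2*Σ-evenTerm N (m / 2) N≤1+2[m/2]) ⟩
  (+ 2) ^ N * (+ 5) ^ t * (+ 5 * (+ N * F (+ N - + 1)) + + 4 * + t * lucℕ N)
    ≡⟨ cong (λ x → (+ 2) ^ N * (+ 5) ^ t * x)
         (cong₂ _+_ (sym (ℤ.*-assoc (+ 5) (+ N) _)) (cong (_* lucℕ N) 4t≡2c)) ⟩
  (+ 2) ^ N * (+ 5) ^ t * (+ 5 * + N * F (+ N - + 1) + + 2 * c * L (+ N))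
    ∎
  where
  N≤1+2[m/2] : N ≤ suc (2 *ℕ (m / 2))
  N≤1+2[m/2] = ℕ.≤-trans (ℕ.m≤m+n N s) (ℕ.≤-trans N+s≤m (m≤1+2[m/2] m))
  above : ∀ j → m / 2 < j → N +ℕ s < a j
  above j m/2<j = subst (N +ℕ s <_) (sym (a≡2j+e j)) (x≤m∧m/2<j⇒x<2j+e e N+s≤m m/2<j)
  below : ∀ j → j < t → a j < s
  below j j<t = subst (_< s) (sym (a≡2j+e j)) (j<t⇒2j+e<2t+e e j<t s≡2t+e)
  shifted : ∀ k → a (t +ℕ k) ≡ 2 *ℕ k +ℕ s
  shifted k = begin
    a (t +ℕ k)            ≡⟨ a≡2j+e (t +ℕ k) ⟩
    2 *ℕ (t +ℕ k) +ℕ e    ≡⟨ ℕ-Solver.solve (t ∷ k ∷ e ∷ []) ⟩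
    2 *ℕ k +ℕ (2 *ℕ t +ℕ e) ≡⟨ cong (2 *ℕ k +ℕ_) s≡2t+e ⟨
    2 *ℕ k +ℕ s           ∎
  4t≡2c : + 4 * + t ≡ + 2 * c
  4t≡2c = trans (ℤ.*-assoc (+ 2) (+ 2) (+ t)) (cong (+ 2 *_) (trans (+2t≡+s-+e t e s≡2t+e) (sym c≡s-e)))

shifted-oddTerm-sum : ∀ N s m t e (a : ℕ → ℕ) {c : ℤ} → N +ℕ s ≤ m →
  (∀ j → a j ≡ 2 *ℕ j +ℕ e) → s +ℕ 1 ≡ 2 *ℕ t +ℕ e → c ≡ + s - + e →
  + 8 * sumFrom1 (m / 2) (λ j → binom N (+ a j - + s) * (+ 5) ^ j * + j)
  ≡ (+ 2) ^ N * (+ 5) ^ t * (+ N * L (+ N - + 1) + + 2 * c * F (+ N))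
shifted-oddTerm-sum N s m t e a {c} N+s≤m a≡2j+e s+1≡2t+e c≡s-e = begin
  + 8 * sumFrom1 (m / 2) (λ j → binom N (+ a j - + s) * (+ 5) ^ j * + j)
    ≡⟨ cong (+ 8 *_) (Σ-binom-reindex N s (m / 2) t a (λ k → suc (2 *ℕ k)) above below shifted) ⟩
  + 8 * ((+ 5) ^ t * (Σ≤ (m / 2) (weighted (oddTerm N)) + + t * Σ≤ (m / 2) (oddTerm N)))
    ≡⟨ scaled-combination ((+ 2) ^ N) ((+ 5) ^ t) (+ t)
         (8*Σ-weighted-oddTerm N (m / 2) N≤2+2[m/2]) (2*Σ-oddTerm N (m / 2) N≤2+2[m/2]) ⟩
  (+ 2) ^ N * (+ 5) ^ t * ((nL[n-1] N - + 2 * fibℕ N) + + 4 * + t * fibℕ N)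
    ≡⟨ cong (λ x → (+ 2) ^ N * (+ 5) ^ t * x) (regroup (nL[n-1] N) (fibℕ N) (+ t)) ⟩
  (+ 2) ^ N * (+ 5) ^ t * (nL[n-1] N + + 2 * (+ 2 * + t - + 1) * fibℕ N)
    ≡⟨ cong (λ x → (+ 2) ^ N * (+ 5) ^ t * (nL[n-1] N + + 2 * x * fibℕ N)) 2t-1≡c ⟩
  (+ 2) ^ N * (+ 5) ^ t * (+ N * L (+ N - + 1) + + 2 * c * F (+ N))
    ∎
  where
  N≤2+2[m/2] : N ≤ suc (suc (2 *ℕ (m / 2)))
  N≤2+2[m/2] = ℕ.m≤n⇒m≤1+n (ℕ.≤-trans (ℕ.m≤m+n N s) (ℕ.≤-trans N+s≤m (m≤1+2[m/2] m)))
  above : ∀ j → m / 2 < j → N +ℕ s < a j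
  above j m/2<j = subst (N +ℕ s <_) (sym (a≡2j+e j)) (x≤m∧m/2<j⇒x<2j+e e N+s≤m m/2<j)
  below : ∀ j → j < t → a j < s
  below j j<t = subst (_< s) (sym (a≡2j+e j)) (j<t⇒2j+e<2t+e-1 e j<t s+1≡2t+e)
  shifted : ∀ k → a (t +ℕ k) ≡ suc (2 *ℕ k) +ℕ s
  shifted k = begin
    a (t +ℕ k)               ≡⟨ a≡2j+e (t +ℕ k) ⟩
    2 *ℕ (t +ℕ k) +ℕ e       ≡⟨ ℕ-Solver.solve (t ∷ k ∷ e ∷ []) ⟩
    2 *ℕ k +ℕ (2 *ℕ t +ℕ e)  ≡⟨ cong (2 *ℕ k +ℕ_) s+1≡2t+e ⟨
    2 *ℕ k +ℕ (s +ℕ 1)       ≡⟨ ℕ-Solver.solve (k ∷ s ∷ []) ⟩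
    suc (2 *ℕ k) +ℕ s        ∎
  regroup : ∀ h f t → (h - + 2 * f) + + 4 * t * f ≡ h + + 2 * (+ 2 * t - + 1) * f
  regroup = solve-∀
  shift-down : ∀ S E → S + + 1 - E - + 1 ≡ S - E
  shift-down = solve-∀
  2t-1≡c : + 2 * + t - + 1 ≡ c
  2t-1≡c = begin
    + 2 * + t - + 1          ≡⟨ cong (_- + 1) (+2t≡+s-+e t e s+1≡2t+e) ⟩
    + s + + 1 - + e - + 1    ≡⟨ shift-down (+ s) (+ e) ⟩
    + s - + e                ≡⟨ c≡s-e ⟨
    c                        ∎

theorem24 : (n r s : ℕ) → r ≤ n → s ≤ r →
    ((s % 2 ≡ 1) →
      ((+ 8 * sumFrom1 (n / 2) (λ j → binom (n ∸ r) (+ (2 *ℕ j) - + s) * ((+ 5) ^ j) * + j)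
         ≡ ((+ 2) ^ (n ∸ r)) * ((+ 5) ^ ((s +ℕ 1) / 2))
           * (+ (n ∸ r) * L (+ (n ∸ r) - + 1) + + 2 * + s * F (+ (n ∸ r))))
      × (+ 8 * sumFrom1 (n / 2) (λ j → binom (n ∸ r) (+ (2 *ℕ j +ℕ 1) - + s) * ((+ 5) ^ j) * + j)
         ≡ ((+ 2) ^ (n ∸ r)) * ((+ 5) ^ ((s ∸ 1) / 2))
           * (+ 5 * + (n ∸ r) * F (+ (n ∸ r) - + 1) + + 2 * (+ s - + 1) * L (+ (n ∸ r))))))
    × ((s % 2 ≡ 0) →
      ((+ 8 * sumFrom1 (n / 2) (λ j → binom (n ∸ r) (+ (2 *ℕ j) - + s) * ((+ 5) ^ j) * + j)
         ≡ ((+ 2) ^ (n ∸ r)) * ((+ 5) ^ (s / 2))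
           * (+ 5 * + (n ∸ r) * F (+ (n ∸ r) - + 1) + + 2 * + s * L (+ (n ∸ r))))
      × (+ 8 * sumFrom1 (n / 2) (λ j → binom (n ∸ r) (+ (2 *ℕ j +ℕ 1) - + s) * ((+ 5) ^ j) * + j)
         ≡ ((+ 2) ^ (n ∸ r)) * ((+ 5) ^ (s / 2))
           * (+ (n ∸ r) * L (+ (n ∸ r) - + 1) + + 2 * (+ s - + 1) * F (+ (n ∸ r))))))
theorem24 n r s r≤n s≤r =
  (λ s-odd →
      shifted-oddTerm-sum N s n ((s +ℕ 1) / 2) 0 (2 *ℕ_) N+s≤n 2j≡2j+0 (m%2≡1⇒m+1≡2[[m+1]/2] s s-odd) s≡s-0
    , shifted-evenTerm-sum N s n ((s ∸ 1) / 2) 1 (λ j → 2 *ℕ j +ℕ 1) N+s≤n (λ _ → refl)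
        (m%2≡1⇒m≡2[[m∸1]/2]+1 s s-odd) refl)
  , (λ s-even →
      shifted-evenTerm-sum N s n (s / 2) 0 (2 *ℕ_) N+s≤n 2j≡2j+0 (m%2≡0⇒m≡2[m/2] s s-even) s≡s-0
    , shifted-oddTerm-sum N s n (s / 2) 1 (λ j → 2 *ℕ j +ℕ 1) N+s≤n (λ _ → refl)
        (m%2≡0⇒m+1≡2[m/2]+1 s s-even) refl)
  where
  N : ℕ
  N = n ∸ r
  N+s≤n : N +ℕ s ≤ n
  N+s≤n = ℕ.≤-trans (ℕ.+-monoʳ-≤ (n ∸ r) s≤r) (ℕ.≤-reflexive (ℕ.m∸n+n≡m r≤n))
  2j≡2j+0 : ∀ j → 2 *ℕ j ≡ 2 *ℕ j +ℕ 0
  2j≡2j+0 j = sym (ℕ.+-identityʳ (2 *ℕ j))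
  s≡s-0 : + s ≡ + s - + 0
  s≡s-0 = sym (ℤ.+-identityʳ (+ s))
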